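{- Let $(\mathbf{R},\mathbb{I})$ be a realizer category such that $\partial_{\mathbf{R}}$ is an isomorphism of double categories. A morphism $F$ of $\mathbf{PGAsm}(\mathbf{R},\mathbb{I})$ is an isofibration internal to the 2-category $\mathbf{PGAsm}(\mathbf{R},\mathbb{I})$ if and only if its underlying functor is an isofibration of groupoids.
   Context: Let $\mathbf{R}$ be a cartesian closed category with terminal object $1$ and $\mathbb{I}$ an interval in $\mathbf{R}$: an internal cogroupoid with objects $\mathbb{I}_0=1,\mathbb{I}_1,\mathbb{I}_2,\mathbb{I}_3$, maps $0,1:\mathbb{I}_0\to\mathbb{I}_1$, $*:\mathbb{I}_1\to\mathbb{I}_0$, $\sigma:\mathbb{I}_1\to\mathbb{I}_1$, $i_0,i_1,2:\mathbb{I}_1\to\mathbb{I}_2$, $j_0,j_1:\mathbb{I}_2\to\mathbb{I}_3$, with $i_0\circ1=i_1\circ0$ and $j_1i_0=j_0i_1$ pushout squares and the cogroupoid axioms holding (equivalently, for each $A$ the following data form a groupoid $\Pi A$): objects maps $a:\mathbb{I}_0\to A$, morphisms $\alpha:a\to b$ maps $\alpha:\mathbb{I}_1\to A$ with $\alpha0=a$, $\alpha1=b$, composite $[\beta,\alpha]\circ2$ (where $[\beta,\alpha]i_0=\alpha$, $[\beta,\alpha]i_1=\beta$), identity $a*$, inverse $\alpha\sigma$; $\Pi(f)$ is postcomposition. $(\mathbf{R},\mathbb{I})$ is then a realizer category. A homotopy $H:f\Rightarrow g:A\to B$ in $\mathbf{R}$ is a map $H:A\times\mathbb{I}_1\to B$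 with $H\langle\mathrm{id},0!\rangle=f$, $H\langle\mathrm{id},1!\rangle=g$; homotopies between maps $A\to B$ form a groupoid (composition $H'\circ H=[H',H]\circ(A\times2)$). "$\partial_{\mathbf{R}}$ is an isomorphism" means: for all $A,B$, every commuting square of homotopies between maps $A\to B$ is the boundary (obtained by restricting one coordinate to $0$ or $1$) of a unique map $A\times\mathbb{I}_1\times\mathbb{I}_1\to B$. $\mathbf{PGAsm}(\mathbf{R},\mathbb{I})$: objects $(X,A,\Vert-\Vert_X)$ with $X$ a small groupoid, $A\in\mathbf{R}$, $\Vert-\Vert_X:X\to\Pi A$ a functor; morphisms are functors $F:X\to Y$ for which there exist $e:A\to B$ and a natural iso $\epsilon:\Pi(e)\Vert-\Vert_X\Rightarrow\Vert-\Vert_YF$. Products: $(X\times Y,A\times B,\langle\Vert\pi_1-\Vert,\Vert\pi_2-\Vert\rangle)$. With $\mathbf{I}_1$ = (walking isomorphism $i:0\to1$, realizer type $\mathbb{I}_1$, $\Vert0\Vert=0,\Vert1\Vert=1,\Vert i\Vert=\mathrm{id}_{\mathbb{I}_1}$), a 2-cell $F\Rightarrow G$ is a morphism $\Phi:X\times\mathbf{I}_1\to Y$ with $\Phi(-,0)=F,\Phi(-,1)=G$ (a realized natural isomorphism); this makes $\mathbf{PGAsm}(\mathbf{R},\mathbb{I})$ a (2,1)-category. In a 2-category, a morphism $p:Y\to Z$ is an isofibration if for every $f:X\to Y$, $g:X\to Z$ and invertible 2-cell $\phi:pf\Rightarrow g$ there exist $f':X\to Y$ with $pf'=g$ and an invertible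 2-cell $\overline\phi:f\Rightarrow f'$ with $p\ast\overline\phi=\phi$. In $\mathbf{Gpd}$ this is the usual notion of isofibration. -}

module Defs where

open import Level using (Level; _⊔_) renaming (suc to lsuc; zero to lzero)
open import Data.Bool using (Bool; true; false)
open import Data.Unit using (⊤; tt)
open import Data.Product using (Σ; _×_; _,_; proj₁; proj₂)
open import Relation.Binary.PropositionalEquality
  using (_≡_; refl; sym; trans; cong; cong₂; subst₂)

record Category (o ℓ : Level) : Set (lsuc (o ⊔ ℓ)) where
  infixr 9 _∘_
  field
    Obj : Set o
    Hom : Obj → Obj → Set ℓ
    id  : ∀ {A} → Hom A A
    _∘_ : ∀ {A B C} → Hom B C → Hom A B → Hom A C
    assoc : ∀ {A B C D} (f : Hom A B) (g : Hom B C) (h : Hom C D) →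
            (h ∘ g) ∘ f ≡ h ∘ (g ∘ f)
    identityˡ : ∀ {A B} (f : Hom A B) → id ∘ f ≡ f
    identityʳ : ∀ {A B} (f : Hom A B) → f ∘ id ≡ f

record CartesianClosed {o ℓ} (C : Category o ℓ) : Set (o ⊔ ℓ) where
  open Category C
  infixr 7 _⊗_
  field
    𝟙 : Obj
    ! : ∀ {A} → Hom A 𝟙
    !-unique : ∀ {A} (f : Hom A 𝟙) → f ≡ !
    _⊗_ : Obj → Obj → Obj
    π₁ : ∀ {A B} → Hom (A ⊗ B) A
    π₂ : ∀ {A B} → Hom (A ⊗ B) B
    ⟨_,_⟩ : ∀ {X A B} → Hom X A → Hom X B → Hom X (A ⊗ B)
    π₁-⟨⟩ : ∀ {X A B} (f : Hom X A) (g : Hom X B) → π₁ ∘ ⟨ f , g ⟩ ≡ f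
    π₂-⟨⟩ : ∀ {X A B} (f : Hom X A) (g : Hom X B) → π₂ ∘ ⟨ f , g ⟩ ≡ g
    ⟨⟩-unique : ∀ {X A B} (f : Hom X A) (g : Hom X B) (u : Hom X (A ⊗ B)) →
                π₁ ∘ u ≡ f → π₂ ∘ u ≡ g → u ≡ ⟨ f , g ⟩
    _^_ : Obj → Obj → Obj
    eval : ∀ {A B} → Hom ((B ^ A) ⊗ A) B
    curry : ∀ {X A B} → Hom (X ⊗ A) B → Hom X (B ^ A)
    eval-curry : ∀ {X A B} (f : Hom (X ⊗ A) B) →
                 eval ∘ ⟨ curry f ∘ π₁ , π₂ ⟩ ≡ f
    curry-unique : ∀ {X A B} (f : Hom (X ⊗ A) B) (u : Hom X (B ^ A)) →
                   eval ∘ ⟨ u ∘ π₁ , π₂ ⟩ ≡ f → u ≡ curry f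

record IsPushout {o ℓ} (C : Category o ℓ) {S P Q W : Category.Obj C}
       (f : Category.Hom C S P) (g : Category.Hom C S Q)
       (p : Category.Hom C P W) (q : Category.Hom C Q W) : Set (o ⊔ ℓ) where
  open Category C
  field
    commutes : p ∘ f ≡ q ∘ g
    copair : ∀ {T} (h : Hom P T) (k : Hom Q T) → h ∘ f ≡ k ∘ g → Hom W T
    copair-p : ∀ {T} (h : Hom P T) (k : Hom Q T) (e : h ∘ f ≡ k ∘ g) →
               copair h k e ∘ p ≡ h
    copair-q : ∀ {T} (h : Hom P T) (k : Hom Q T) (e : h ∘ f ≡ k ∘ g) →
               copair h k e ∘ q ≡ k
    copair-unique : ∀ {T} (h : Hom P T) (k : Hom Q T) (e : h ∘ f ≡ k ∘ g)
                    (u : Hom W T) → u ∘ p ≡ h → u ∘ q ≡ k → u ≡ copair h k e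

-- Interval data: I₀ = 𝟙, I₁, I₂, I₃ with the structure maps.
-- ι₀, ι₁ are the maps 0, 1 : I₀ → I₁;  two is the map 2 : I₁ → I₂.

record IntervalData {o ℓ} (C : Category o ℓ) (T : CartesianClosed C) : Set (o ⊔ ℓ) where
  open Category C
  open CartesianClosed T
  field
    𝕀₁ 𝕀₂ 𝕀₃ : Obj
    ι₀ ι₁ : Hom 𝟙 𝕀₁
    * : Hom 𝕀₁ 𝟙
    σ : Hom 𝕀₁ 𝕀₁
    i₀ i₁ two : Hom 𝕀₁ 𝕀₂
    j₀ j₁ : Hom 𝕀₂ 𝕀₃
    push₂ : IsPushout C ι₁ ι₀ i₀ i₁
    push₃ : IsPushout C i₁ i₀ j₀ j₁
    two-src : two ∘ ι₀ ≡ i₀ ∘ ι₀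
    two-tgt : two ∘ ι₁ ≡ i₁ ∘ ι₁
    σ-src : σ ∘ ι₀ ≡ ι₁
    σ-tgt : σ ∘ ι₁ ≡ ι₀

module PiData {o ℓ} {C : Category o ℓ} {T : CartesianClosed C}
              (I : IntervalData C T) where
  open Category C
  open CartesianClosed T
  open IntervalData I
  open IsPushout push₂

  *-ι₀ : * ∘ ι₀ ≡ id
  *-ι₀ = trans (!-unique _) (sym (!-unique id))

  *-ι₁ : * ∘ ι₁ ≡ id
  *-ι₁ = trans (!-unique _) (sym (!-unique id))

  record PiHom (A : Obj) (a b : Hom 𝟙 A) : Set ℓ where
    constructor pihom
    field
      path : Hom 𝕀₁ A
      path-src : path ∘ ι₀ ≡ a
      path-tgt : path ∘ ι₁ ≡ b
  open PiHom public

  pid : ∀ {A} (a : Hom 𝟙 A) → PiHom A a a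
  pid a = pihom (a ∘ *)
    (trans (assoc ι₀ * a) (trans (cong (a ∘_) *-ι₀) (identityʳ a)))
    (trans (assoc ι₁ * a) (trans (cong (a ∘_) *-ι₁) (identityʳ a)))

  bracket : ∀ {A a b c} → PiHom A b c → PiHom A a b → Hom 𝕀₂ A
  bracket β α = copair (path α) (path β) (trans (path-tgt α) (sym (path-src β)))

  pcomp : ∀ {A a b c} → PiHom A b c → PiHom A a b → PiHom A a c
  pcomp β α = pihom (bracket β α ∘ two)
    (trans (assoc ι₀ two (bracket β α))
     (trans (cong (bracket β α ∘_) two-src)
      (trans (sym (assoc ι₀ i₀ (bracket β α)))
       (trans (cong (_∘ ι₀) (copair-p _ _ _)) (path-src α)))))
    (trans (assoc ι₁ two (bracket β α))
     (trans (cong (bracket β α ∘_) two-tgt)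
      (trans (sym (assoc ι₁ i₁ (bracket β α)))
       (trans (cong (_∘ ι₁) (copair-q _ _ _)) (path-tgt β)))))

  pinv : ∀ {A a b} → PiHom A a b → PiHom A b a
  pinv α = pihom (path α ∘ σ)
    (trans (assoc ι₀ σ (path α)) (trans (cong (path α ∘_) σ-src) (path-tgt α)))
    (trans (assoc ι₁ σ (path α)) (trans (cong (path α ∘_) σ-tgt) (path-src α)))

  bracket-cong : ∀ {A a b c} {β β' : PiHom A b c} {α α' : PiHom A a b} →
                 path β ≡ path β' → path α ≡ path α' → bracket β α ≡ bracket β' α'
  bracket-cong {β = β} {β'} {α} {α'} eβ eα =
    copair-unique _ _ _ (bracket β α)
      (trans (copair-p _ _ _) eα) (trans (copair-q _ _ _) eβ)

-- Remaining cogroupoid axioms, in the equivalent form: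
-- for every A, the data Π A satisfy the groupoid laws.
record IntervalLaws {o ℓ} {C : Category o ℓ} {T : CartesianClosed C}
                    (I : IntervalData C T) : Set (o ⊔ ℓ) where
  open Category C
  open CartesianClosed T
  open PiData I
  field
    Π-assoc : ∀ {A} {a b c d : Hom 𝟙 A} (f : PiHom A a b) (g : PiHom A b c)
              (h : PiHom A c d) →
              path (pcomp (pcomp h g) f) ≡ path (pcomp h (pcomp g f))
    Π-identityˡ : ∀ {A} {a b : Hom 𝟙 A} (f : PiHom A a b) →
                  path (pcomp (pid b) f) ≡ path f
    Π-identityʳ : ∀ {A} {a b : Hom 𝟙 A} (f : PiHom A a b) →
                  path (pcomp f (pid a)) ≡ path f
    Π-inverseˡ : ∀ {A} {a b : Hom 𝟙 A} (f : PiHom A a b) →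
                 path (pcomp (pinv f) f) ≡ path (pid a)
    Π-inverseʳ : ∀ {A} {a b : Hom 𝟙 A} (f : PiHom A a b) →
                 path (pcomp f (pinv f)) ≡ path (pid b)

record RealizerCategory (o ℓ : Level) : Set (lsuc (o ⊔ ℓ)) where
  field
    cat : Category o ℓ
    ccc : CartesianClosed cat
    interval : IntervalData cat ccc
    intervalLaws : IntervalLaws interval

record Groupoid (o h e : Level) : Set (lsuc (o ⊔ h ⊔ e)) where
  infixr 9 _∘_
  infix 4 _≈_
  field
    Obj : Set o
    Hom : Obj → Obj → Set h
    _≈_ : ∀ {x y} → Hom x y → Hom x y → Set e
    id : ∀ {x} → Hom x x
    _∘_ : ∀ {x y z} → Hom y z → Hom x y → Hom x z
    _⁻¹ : ∀ {x y} → Hom x y → Hom y x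
    ≈-refl : ∀ {x y} {f : Hom x y} → f ≈ f
    ≈-sym : ∀ {x y} {f g : Hom x y} → f ≈ g → g ≈ f
    ≈-trans : ∀ {x y} {f g k : Hom x y} → f ≈ g → g ≈ k → f ≈ k
    ∘-resp-≈ : ∀ {x y z} {f f' : Hom x y} {g g' : Hom y z} →
               g ≈ g' → f ≈ f' → g ∘ f ≈ g' ∘ f'
    assoc : ∀ {w x y z} (f : Hom w x) (g : Hom x y) (k : Hom y z) →
            (k ∘ g) ∘ f ≈ k ∘ (g ∘ f)
    identityˡ : ∀ {x y} (f : Hom x y) → id ∘ f ≈ f
    identityʳ : ∀ {x y} (f : Hom x y) → f ∘ id ≈ f
    inverseˡ : ∀ {x y} (f : Hom x y) → (f ⁻¹) ∘ f ≈ id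
    inverseʳ : ∀ {x y} (f : Hom x y) → f ∘ (f ⁻¹) ≈ id

record Functor {o h e o' h' e'} (X : Groupoid o h e) (Y : Groupoid o' h' e')
       : Set (o ⊔ h ⊔ e ⊔ o' ⊔ h' ⊔ e') where
  private
    module X = Groupoid X
    module Y = Groupoid Y
  field
    F₀ : X.Obj → Y.Obj
    F₁ : ∀ {x y} → X.Hom x y → Y.Hom (F₀ x) (F₀ y)
    F-resp-≈ : ∀ {x y} {f g : X.Hom x y} → f X.≈ g → F₁ f Y.≈ F₁ g
    F-id : ∀ {x} → F₁ (X.id {x}) Y.≈ Y.id
    F-∘ : ∀ {x y z} (f : X.Hom x y) (g : X.Hom y z) →
          F₁ (g X.∘ f) Y.≈ (F₁ g Y.∘ F₁ f)
open Functor public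

record NatTrans {o h e o' h' e'} {X : Groupoid o h e} {Y : Groupoid o' h' e'}
       (F G : Functor X Y) : Set (o ⊔ h ⊔ e ⊔ o' ⊔ h' ⊔ e') where
  private
    module X = Groupoid X
    module Y = Groupoid Y
  field
    η : ∀ x → Y.Hom (F₀ F x) (F₀ G x)
    natural : ∀ {x y} (f : X.Hom x y) → (η y Y.∘ F₁ F f) Y.≈ (F₁ G f Y.∘ η x)

FunctorEq : ∀ {o h e o' h' e'} {X : Groupoid o h e} {Y : Groupoid o' h' e'} →
            Functor X Y → Functor X Y → Set (o ⊔ h ⊔ o' ⊔ e')
FunctorEq {X = X} {Y} F G =
  Σ (∀ x → F₀ F x ≡ F₀ G x) λ eq →
    ∀ {x y} (f : Groupoid.Hom X x y) →
      Groupoid._≈_ Y (subst₂ (Groupoid.Hom Y) (eq x) (eq y) (F₁ F f)) (F₁ G f)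

_∘F_ : ∀ {o h e o' h' e' o'' h'' e''} {X : Groupoid o h e}
       {Y : Groupoid o' h' e'} {Z : Groupoid o'' h'' e''} →
       Functor Y Z → Functor X Y → Functor X Z
_∘F_ {Z = Z} G F = record
  { F₀ = λ x → F₀ G (F₀ F x)
  ; F₁ = λ f → F₁ G (F₁ F f)
  ; F-resp-≈ = λ p → F-resp-≈ G (F-resp-≈ F p)
  ; F-id = Groupoid.≈-trans Z (F-resp-≈ G (F-id F)) (F-id G)
  ; F-∘ = λ f g → Groupoid.≈-trans Z (F-resp-≈ G (F-∘ F f g)) (F-∘ G _ _)
  }

_×G_ : ∀ {o h e o' h' e'} → Groupoid o h e → Groupoid o' h' e' →
       Groupoid (o ⊔ o') (h ⊔ h') (e ⊔ e')
X ×G Y = record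
  { Obj = X.Obj × Y.Obj
  ; Hom = λ p q → X.Hom (proj₁ p) (proj₁ q) × Y.Hom (proj₂ p) (proj₂ q)
  ; _≈_ = λ f g → (proj₁ f X.≈ proj₁ g) × (proj₂ f Y.≈ proj₂ g)
  ; id = X.id , Y.id
  ; _∘_ = λ g f → (proj₁ g X.∘ proj₁ f) , (proj₂ g Y.∘ proj₂ f)
  ; _⁻¹ = λ f → (proj₁ f X.⁻¹) , (proj₂ f Y.⁻¹)
  ; ≈-refl = X.≈-refl , Y.≈-refl
  ; ≈-sym = λ p → X.≈-sym (proj₁ p) , Y.≈-sym (proj₂ p)
  ; ≈-trans = λ p q → X.≈-trans (proj₁ p) (proj₁ q) , Y.≈-trans (proj₂ p) (proj₂ q)
  ; ∘-resp-≈ = λ p q → X.∘-resp-≈ (proj₁ p) (proj₁ q) , Y.∘-resp-≈ (proj₂ p) (proj₂ q)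
  ; assoc = λ f g k → X.assoc _ _ _ , Y.assoc _ _ _
  ; identityˡ = λ f → X.identityˡ _ , Y.identityˡ _
  ; identityʳ = λ f → X.identityʳ _ , Y.identityʳ _
  ; inverseˡ = λ f → X.inverseˡ _ , Y.inverseˡ _
  ; inverseʳ = λ f → X.inverseʳ _ , Y.inverseʳ _
  }
  where
    module X = Groupoid X
    module Y = Groupoid Y

πF₁ : ∀ {o h e o' h' e'} {X : Groupoid o h e} {Y : Groupoid o' h' e'} →
      Functor (X ×G Y) X
πF₁ {X = X} = record
  { F₀ = proj₁ ; F₁ = proj₁ ; F-resp-≈ = proj₁
  ; F-id = Groupoid.≈-refl X ; F-∘ = λ f g → Groupoid.≈-refl X }

πF₂ : ∀ {o h e o' h' e'} {X : Groupoid o h e} {Y : Groupoid o' h' e'} →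
      Functor (X ×G Y) Y
πF₂ {Y = Y} = record
  { F₀ = proj₂ ; F₁ = proj₂ ; F-resp-≈ = proj₂
  ; F-id = Groupoid.≈-refl Y ; F-∘ = λ f g → Groupoid.≈-refl Y }

-- The walking isomorphism i : 0 → 1  (false = 0, true = 1)
𝐈 : Groupoid lzero lzero lzero
𝐈 = record
  { Obj = Bool ; Hom = λ _ _ → ⊤ ; _≈_ = λ _ _ → ⊤
  ; id = tt ; _∘_ = λ _ _ → tt ; _⁻¹ = λ _ → tt
  ; ≈-refl = tt ; ≈-sym = λ _ → tt ; ≈-trans = λ _ _ → tt
  ; ∘-resp-≈ = λ _ _ → tt ; assoc = λ _ _ _ → tt
  ; identityˡ = λ _ → tt ; identityʳ = λ _ → tt
  ; inverseˡ = λ _ → tt ; inverseʳ = λ _ → tt }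

incl : ∀ {o h e} {X : Groupoid o h e} → Bool → Functor X (X ×G 𝐈)
incl {X = X} b = record
  { F₀ = λ x → x , b ; F₁ = λ f → f , tt ; F-resp-≈ = λ p → p , tt
  ; F-id = Groupoid.≈-refl X , tt ; F-∘ = λ f g → Groupoid.≈-refl X , tt }

IsIsofibrationGpd : ∀ {o h e o' h' e'} {Y : Groupoid o h e} {Z : Groupoid o' h' e'} →
                    Functor Y Z → Set (o ⊔ h ⊔ o' ⊔ h' ⊔ e')
IsIsofibrationGpd {Y = Y} {Z} P =
  ∀ (y : Groupoid.Obj Y) (z : Groupoid.Obj Z)
    (φ : Groupoid.Hom Z (F₀ P y) z) →
  Σ (Groupoid.Obj Y) λ y' →
  Σ (F₀ P y' ≡ z) λ p →
  Σ (Groupoid.Hom Y y y') λ ψ →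
    Groupoid._≈_ Z (subst₂ (Groupoid.Hom Z) refl p (F₁ P ψ)) φ

module Realizer {o ℓ} (𝐑 : RealizerCategory o ℓ) where
  open RealizerCategory 𝐑
  open Category cat
  open CartesianClosed ccc
  open IntervalData interval
  open IntervalLaws intervalLaws
  open PiData interval public
  open IsPushout push₂

  Π : Obj → Groupoid ℓ ℓ ℓ
  Π A = record
    { Obj = Hom 𝟙 A
    ; Hom = PiHom A
    ; _≈_ = λ α β → path α ≡ path β
    ; id = pid _
    ; _∘_ = pcomp
    ; _⁻¹ = pinv
    ; ≈-refl = refl
    ; ≈-sym = sym
    ; ≈-trans = trans
    ; ∘-resp-≈ = λ {_} {_} {_} {f} {f'} {g} {g'} p q →
        cong (_∘ two) (bracket-cong {β = g} {g'} {f} {f'} p q)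
    ; assoc = Π-assoc
    ; identityˡ = Π-identityˡ
    ; identityʳ = Π-identityʳ
    ; inverseˡ = Π-inverseˡ
    ; inverseʳ = Π-inverseʳ
    }

  Πmap : ∀ {A B} → Hom A B → Functor (Π A) (Π B)
  Πmap e = record
    { F₀ = λ a → e ∘ a
    ; F₁ = λ α → pihom (e ∘ path α)
        (trans (assoc ι₀ (path α) e) (cong (e ∘_) (path-src α)))
        (trans (assoc ι₁ (path α) e) (cong (e ∘_) (path-tgt α)))
    ; F-resp-≈ = cong (e ∘_)
    ; F-id = sym (assoc * _ e)
    ; F-∘ = λ α β →
        trans (sym (assoc two (bracket β α) e))
          (cong (_∘ two)
            (copair-unique _ _ _ (e ∘ bracket β α)
              (trans (assoc i₀ _ e) (cong (e ∘_) (copair-p _ _ _)))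
              (trans (assoc i₁ _ e) (cong (e ∘_) (copair-q _ _ _)))))
    }

  ⟨⟩-∘ : ∀ {W X A B} (f : Hom X A) (g : Hom X B) (k : Hom W X) →
         ⟨ f , g ⟩ ∘ k ≡ ⟨ f ∘ k , g ∘ k ⟩
  ⟨⟩-∘ f g k = ⟨⟩-unique _ _ _
    (trans (sym (assoc k _ π₁)) (cong (_∘ k) (π₁-⟨⟩ f g)))
    (trans (sym (assoc k _ π₂)) (cong (_∘ k) (π₂-⟨⟩ f g)))

  pairF : ∀ {x h e} {W : Groupoid x h e} {A B : Obj} →
          Functor W (Π A) → Functor W (Π B) → Functor W (Π (A ⊗ B))
  pairF {W = W} F G = record
    { F₀ = λ w → ⟨ F₀ F w , F₀ G w ⟩
    ; F₁ = λ f → pihom ⟨ path (F₁ F f) , path (F₁ G f) ⟩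
        (trans (⟨⟩-∘ _ _ ι₀) (cong₂ ⟨_,_⟩ (path-src (F₁ F f)) (path-src (F₁ G f))))
        (trans (⟨⟩-∘ _ _ ι₁) (cong₂ ⟨_,_⟩ (path-tgt (F₁ F f)) (path-tgt (F₁ G f))))
    ; F-resp-≈ = λ p → cong₂ ⟨_,_⟩ (F-resp-≈ F p) (F-resp-≈ G p)
    ; F-id = trans (cong₂ ⟨_,_⟩ (F-id F) (F-id G)) (sym (⟨⟩-∘ _ _ *))
    ; F-∘ = λ f g →
        trans (cong₂ ⟨_,_⟩ (F-∘ F f g) (F-∘ G f g))
          (trans (sym (⟨⟩-∘ _ _ two))
            (cong (_∘ two)
              (copair-unique _ _ _ _
                (trans (⟨⟩-∘ _ _ i₀) (cong₂ ⟨_,_⟩ (copair-p _ _ _) (copair-p _ _ _)))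
                (trans (⟨⟩-∘ _ _ i₁) (cong₂ ⟨_,_⟩ (copair-q _ _ _) (copair-q _ _ _))))))
    }

  private
    pi-id : PiHom 𝕀₁ ι₀ ι₁
    pi-id = pihom id (identityˡ ι₀) (identityˡ ι₁)
    pi-σ : PiHom 𝕀₁ ι₁ ι₀
    pi-σ = pihom σ σ-src σ-tgt
    ptI : Bool → Hom 𝟙 𝕀₁
    ptI false = ι₀
    ptI true = ι₁
    homI : (b c : Bool) → PiHom 𝕀₁ (ptI b) (ptI c)
    homI false false = pid ι₀
    homI false true = pi-id
    homI true false = pi-σ
    homI true true = pid ι₁
    σ≈ : σ ≡ id ∘ σ
    σ≈ = sym (identityˡ σ)
    homI-∘ : (b c d : Bool) →
             path (homI b d) ≡ path (pcomp (homI c d) (homI b c))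
    homI-∘ false false false = sym (Π-identityˡ (pid ι₀))
    homI-∘ false false true = sym (Π-identityʳ pi-id)
    homI-∘ false true false =
      sym (trans (cong (_∘ two) (bracket-cong {β = pi-σ} {β' = pinv pi-id}
                                   {α = pi-id} {α' = pi-id} σ≈ refl))
                 (Π-inverseˡ pi-id))
    homI-∘ false true true = sym (Π-identityˡ pi-id)
    homI-∘ true false false = sym (Π-identityˡ pi-σ)
    homI-∘ true false true =
      sym (trans (cong (_∘ two) (bracket-cong {β = pi-id} {β' = pi-id}
                                   {α = pi-σ} {α' = pinv pi-id} refl σ≈))
                 (Π-inverseʳ pi-id))
    homI-∘ true true false = sym (Π-identityʳ pi-σ)
    homI-∘ true true true = sym (Π-identityˡ (pid ι₁))

  ‖‖𝐈 : Functor 𝐈 (Π 𝕀₁)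
  ‖‖𝐈 = record
    { F₀ = ptI
    ; F₁ = λ {b} {c} _ → homI b c
    ; F-resp-≈ = λ _ → refl
    ; F-id = λ {b} → idcase b
    ; F-∘ = λ {b} {c} {d} _ _ → homI-∘ b c d
    }
    where
      idcase : (b : Bool) → path (homI b b) ≡ path (pid (ptI b))
      idcase false = refl
      idcase true = refl

  record PObj (x h e : Level) : Set (lsuc (x ⊔ h ⊔ e) ⊔ o ⊔ ℓ) where
    constructor pobj
    field
      carrier : Groupoid x h e
      realizer : Obj
      norm : Functor carrier (Π realizer)
  open PObj public

  -- Morphisms: functors F together with a tracking e : A → B and a natural
  -- (iso)morphism ε : Π(e) ‖-‖_X ⇒ ‖-‖_Y F.  (Equality of morphisms used
  -- below is equality of the underlying functors only.)
  record PMor {x h e} (X Y : PObj x h e) : Set (x ⊔ h ⊔ e ⊔ ℓ) where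
    field
      functor : Functor (carrier X) (carrier Y)
      tracker : Hom (realizer X) (realizer Y)
      tracking : NatTrans (Πmap tracker ∘F norm X) (norm Y ∘F functor)
  open PMor public

  _⊗P_ : ∀ {x h e x' h' e'} → PObj x h e → PObj x' h' e' →
         PObj (x ⊔ x') (h ⊔ h') (e ⊔ e')
  X ⊗P Y = pobj (carrier X ×G carrier Y) (realizer X ⊗ realizer Y)
                (pairF (norm X ∘F πF₁) (norm Y ∘F πF₂))

  𝐈₁ : PObj lzero lzero lzero
  𝐈₁ = pobj 𝐈 𝕀₁ ‖‖𝐈

  record TwoCell {x h e} {X Y : PObj x h e}
         (F G : Functor (carrier X) (carrier Y)) : Set (x ⊔ h ⊔ e ⊔ ℓ) where
    field
      cell : PMor (X ⊗P 𝐈₁) Y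
      at₀ : FunctorEq (functor cell ∘F incl false) F
      at₁ : FunctorEq (functor cell ∘F incl true) G
  open TwoCell public

  -- Isofibrations internal to the (2,1)-category PGAsm(R, 𝕀)
  -- (every 2-cell of PGAsm(R, 𝕀) is invertible).
  IsIsofibration₂ : ∀ {x h e} {Y Z : PObj x h e} → PMor Y Z →
                    Set (lsuc (x ⊔ h ⊔ e) ⊔ o ⊔ ℓ)
  IsIsofibration₂ {x} {h} {e} {Y} {Z} p =
    ∀ (X : PObj x h e) (f : PMor X Y) (g : PMor X Z)
      (φ : TwoCell {X = X} {Y = Z} (functor p ∘F functor f) (functor g)) →
    Σ (PMor X Y) λ f' →
      FunctorEq (functor p ∘F functor f') (functor g) ×
      Σ (TwoCell {X = X} {Y = Y} (functor f) (functor f')) λ φ̄ →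
        FunctorEq (functor p ∘F functor (cell φ̄)) (functor (cell φ))

  at : ∀ {A} → Hom 𝟙 𝕀₁ → Hom A (A ⊗ 𝕀₁)
  at t = ⟨ id , t ∘ ! ⟩

  _⊗→_ : ∀ A {K} → Hom 𝕀₁ K → Hom (A ⊗ 𝕀₁) (A ⊗ K)
  A ⊗→ u = ⟨ π₁ , u ∘ π₂ ⟩

  -- L = [K , H] : A ⊗ 𝕀₂ → B  (so that K ∘ H = L ∘ (A ⊗ 2))
  IsBracket : ∀ {A B} → Hom (A ⊗ 𝕀₂) B → Hom (A ⊗ 𝕀₁) B → Hom (A ⊗ 𝕀₁) B → Set ℓ
  IsBracket {A} L H K = (L ∘ (A ⊗→ i₀) ≡ H) × (L ∘ (A ⊗→ i₁) ≡ K)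

  SquareCommutes : ∀ {A B} (H K H' K' : Hom (A ⊗ 𝕀₁) B) → Set ℓ
  SquareCommutes {A} {B} H K H' K' =
    Σ (Hom (A ⊗ 𝕀₂) B) λ L → Σ (Hom (A ⊗ 𝕀₂) B) λ L' →
      IsBracket L H K × IsBracket L' H' K' × (L ∘ (A ⊗→ two) ≡ L' ∘ (A ⊗→ two))

  -- boundary of S : (A ⊗ 𝕀₁) ⊗ 𝕀₁ → B, writing S((a , s) , t):
  --   H = S(-,-,0),  K = S(-,1,-),  H' = S(-,0,-),  K' = S(-,-,1)
  Boundary : ∀ {A B} (S : Hom ((A ⊗ 𝕀₁) ⊗ 𝕀₁) B) (H K H' K' : Hom (A ⊗ 𝕀₁) B) → Set ℓ
  Boundary S H K H' K' =
    (S ∘ at ι₀ ≡ H) × (S ∘ ⟨ at ι₁ ∘ π₁ , π₂ ⟩ ≡ K) ×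
    (S ∘ ⟨ at ι₀ ∘ π₁ , π₂ ⟩ ≡ H') × (S ∘ at ι₁ ≡ K')

  ∂-isIso : Set (o ⊔ ℓ)
  ∂-isIso =
    ∀ {A B : Obj} (H K H' K' : Hom (A ⊗ 𝕀₁) B) →
      H ∘ at ι₀ ≡ H' ∘ at ι₀ →
      H ∘ at ι₁ ≡ K ∘ at ι₀ →
      H' ∘ at ι₁ ≡ K' ∘ at ι₀ →
      K ∘ at ι₁ ≡ K' ∘ at ι₁ →
      SquareCommutes H K H' K' →
      Σ (Hom ((A ⊗ 𝕀₁) ⊗ 𝕀₁) B) λ S →
        Boundary S H K H' K' ×
        (∀ S' → Boundary S' H K H' K' → S' ≡ S)

module Submission where

-- Given a groupoid isofibration F and a 2-cell φ : F f ⇒ g, lift each component of φ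
-- to ψ x : f x → y′ x and conjugate f by ψ; the cylinder X × 𝐈 → Y that is f at 0 and
-- the conjugate at 1 is tracked by the realizer of f composed with π₁, so both the lift
-- and the lifted 2-cell live in PGAsm, and F maps them to g and φ because a conjugate
-- is determined by its components. Conversely, the 2-categorical lifting property for
-- maps out of the one-point assembly is the groupoid one.

open import Level using (Level; Lift; lift)
open import Data.Bool using (Bool; true; false)
open import Data.Unit using (⊤; tt)
open import Data.Product using (_×_; _,_; proj₁; proj₂)
open import Relation.Binary.PropositionalEquality
  using (_≡_; refl; sym; trans; cong; subst₂)
open import Relation.Binary.Bundles using (Setoid)
import Relation.Binary.Reasoning.Setoid as SetoidReasoning
open import Defs
open NatTrans using (η; natural)

private
  variable
    a b c a′ b′ c′ a″ b″ c″ a‴ b‴ c‴ : Level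
    W : Groupoid a‴ b‴ c‴
    X : Groupoid a b c
    Y : Groupoid a′ b′ c′
    Z : Groupoid a″ b″ c″

-- r and r′ are arbitrary: this is uniqueness of identity proofs (axiom K).
subst₂-subst₂ : ∀ {ℓ r} {A : Set ℓ} (R : A → A → Set r) {x x′ x″ y y′ y″ : A}
  (p : x ≡ x′) (q : x′ ≡ x″) (p′ : y ≡ y′) (q′ : y′ ≡ y″)
  (r : x ≡ x″) (r′ : y ≡ y″) (k : R x y) →
  subst₂ R q q′ (subst₂ R p p′ k) ≡ subst₂ R r r′ k
subst₂-subst₂ R refl refl refl refl refl refl k = refl

module GroupoidProperties (G : Groupoid a b c) where
  open Groupoid G

  homSetoid : Obj → Obj → Setoid b c
  homSetoid x y = record
    { Carrier = Hom x y ; _≈_ = _≈_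
    ; isEquivalence = record { refl = ≈-refl ; sym = ≈-sym ; trans = ≈-trans } }

  module HomReasoning {x y : Obj} = SetoidReasoning (homSetoid x y)

  ∘-resp-≈ˡ : ∀ {x y z} {f : Hom x y} {g g′ : Hom y z} → g ≈ g′ → g ∘ f ≈ g′ ∘ f
  ∘-resp-≈ˡ p = ∘-resp-≈ p ≈-refl

  ∘-resp-≈ʳ : ∀ {x y z} {f f′ : Hom x y} {g : Hom y z} → f ≈ f′ → g ∘ f ≈ g ∘ f′
  ∘-resp-≈ʳ p = ∘-resp-≈ ≈-refl p

  sym-assoc : ∀ {w x y z} {f : Hom w x} {g : Hom x y} {k : Hom y z} →
              k ∘ (g ∘ f) ≈ (k ∘ g) ∘ f
  sym-assoc = ≈-sym (assoc _ _ _)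

  cancelˡ : ∀ {w x y} {g : Hom x y} {g′ : Hom y x} {f : Hom w x} →
            g′ ∘ g ≈ id → g′ ∘ (g ∘ f) ≈ f
  cancelˡ inv = ≈-trans sym-assoc (≈-trans (∘-resp-≈ˡ inv) (identityˡ _))

  cancelʳ : ∀ {x y z} {g : Hom x y} {g′ : Hom y x} {f : Hom y z} →
            g ∘ g′ ≈ id → (f ∘ g) ∘ g′ ≈ f
  cancelʳ inv = ≈-trans (assoc _ _ _) (≈-trans (∘-resp-≈ʳ inv) (identityʳ _))

  id⁻¹≈id : ∀ {x} → id {x} ⁻¹ ≈ id
  id⁻¹≈id = ≈-trans (≈-sym (identityˡ _)) (inverseʳ id)

  idTo : ∀ {x y} → x ≡ y → Hom x y
  idTo refl = id

  subst₂-resp-≈ : ∀ {x x′ y y′} (p : x ≡ x′) (q : y ≡ y′) {k k′ : Hom x y} →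
                  k ≈ k′ → subst₂ Hom p q k ≈ subst₂ Hom p q k′
  subst₂-resp-≈ refl refl s = s

  subst₂-sym-≈ : ∀ {x x′ y y′} (p : x ≡ x′) (q : y ≡ y′) {k : Hom x y} {k′ : Hom x′ y′} →
                 subst₂ Hom p q k ≈ k′ → subst₂ Hom (sym p) (sym q) k′ ≈ k
  subst₂-sym-≈ refl refl s = ≈-sym s

  subst₂-≈⇒idTo-square : ∀ {x x′ y y′} (p : x ≡ x′) (q : y ≡ y′) {k : Hom x y} {k′ : Hom x′ y′} →
                         subst₂ Hom p q k ≈ k′ → idTo q ∘ k ≈ k′ ∘ idTo p
  subst₂-≈⇒idTo-square refl refl s = ≈-trans (identityˡ _) (≈-trans s (≈-sym (identityʳ _)))

  idTo-square⇒subst₂-≈ : ∀ {x x′ y y′} (p : x ≡ x′) (q : y ≡ y′) {k : Hom x y} {k′ : Hom x′ y′} →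
                         idTo q ∘ k ≈ k′ ∘ idTo p → subst₂ Hom p q k ≈ k′
  idTo-square⇒subst₂-≈ refl refl s = ≈-trans (≈-sym (identityˡ _)) (≈-trans s (identityʳ _))

F₁-subst₂ : (P : Functor Y Z) {y₁ y₁′ y₂ y₂′ : Groupoid.Obj Y}
  (p : y₁ ≡ y₁′) (q : y₂ ≡ y₂′) (k : Groupoid.Hom Y y₁ y₂) →
  F₁ P (subst₂ (Groupoid.Hom Y) p q k) ≡
  subst₂ (Groupoid.Hom Z) (cong (F₀ P) p) (cong (F₀ P) q) (F₁ P k)
F₁-subst₂ P refl refl k = refl

F-inverseʳ : (N : Functor Y Z) {y₁ y₂ : Groupoid.Obj Y} (f : Groupoid.Hom Y y₁ y₂) →
  Groupoid._≈_ Z (Groupoid._∘_ Z (F₁ N f) (F₁ N (Groupoid._⁻¹ Y f))) (Groupoid.id Z)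
F-inverseʳ {Y = Y} {Z = Z} N f =
  Z.≈-trans (Z.≈-sym (F-∘ N _ _)) (Z.≈-trans (F-resp-≈ N (Groupoid.inverseʳ Y f)) (F-id N))
  where module Z = Groupoid Z

constF : (X : Groupoid a b c) (Y : Groupoid a′ b′ c′) → Groupoid.Obj Y → Functor X Y
constF X Y y = record
  { F₀ = λ _ → y ; F₁ = λ _ → Y.id ; F-resp-≈ = λ _ → Y.≈-refl
  ; F-id = Y.≈-refl ; F-∘ = λ _ _ → Y.≈-sym (Y.identityˡ _) }
  where module Y = Groupoid Y

module _ {X : Groupoid a b c} {Y : Groupoid a′ b′ c′} where
  private
    module X = Groupoid X
    module Y = Groupoid Y
  open Groupoid Y
  open GroupoidProperties Y

  conjugate : (G : Functor X Y) (H₀ : X.Obj → Obj) (θ : ∀ x → Hom (F₀ G x) (H₀ x)) →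
              Functor X Y
  conjugate G H₀ θ = record
    { F₀ = H₀
    ; F₁ = λ {x} {y} u → θ y ∘ (F₁ G u ∘ θ x ⁻¹)
    ; F-resp-≈ = λ s → ∘-resp-≈ʳ (∘-resp-≈ˡ (F-resp-≈ G s))
    ; F-id = λ {x} → begin
        θ x ∘ (F₁ G X.id ∘ θ x ⁻¹) ≈⟨ ∘-resp-≈ʳ (∘-resp-≈ˡ (F-id G)) ⟩
        θ x ∘ (id ∘ θ x ⁻¹)        ≈⟨ ∘-resp-≈ʳ (identityˡ _) ⟩
        θ x ∘ θ x ⁻¹               ≈⟨ inverseʳ _ ⟩
        id                         ∎
    ; F-∘ = λ {x} {y} {z} f g → begin
        θ z ∘ (F₁ G (g X.∘ f) ∘ θ x ⁻¹)
          ≈⟨ ∘-resp-≈ʳ (≈-trans (∘-resp-≈ˡ (F-∘ G f g)) (assoc _ _ _)) ⟩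
        θ z ∘ (F₁ G g ∘ (F₁ G f ∘ θ x ⁻¹))
          ≈⟨ ∘-resp-≈ʳ (∘-resp-≈ʳ (≈-sym (cancelˡ (inverseˡ (θ y))))) ⟩
        θ z ∘ (F₁ G g ∘ (θ y ⁻¹ ∘ (θ y ∘ (F₁ G f ∘ θ x ⁻¹))))
          ≈⟨ ≈-trans (∘-resp-≈ʳ sym-assoc) sym-assoc ⟩
        (θ z ∘ (F₁ G g ∘ θ y ⁻¹)) ∘ (θ y ∘ (F₁ G f ∘ θ x ⁻¹)) ∎
    }
    where open HomReasoning

  conjugateIso : (G : Functor X Y) (H₀ : X.Obj → Obj) (θ : ∀ x → Hom (F₀ G x) (H₀ x)) →
                 NatTrans G (conjugate G H₀ θ)
  conjugateIso G H₀ θ = record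
    { η = θ
    ; natural = λ {x} {y} u → ≈-sym (≈-trans (assoc _ _ _)
        (∘-resp-≈ʳ (cancelʳ (inverseˡ (θ x)))))
    }

  FunctorEq-trans : {F G H : Functor X Y} → FunctorEq F G → FunctorEq G H → FunctorEq F H
  FunctorEq-trans {F = F} {H = H} (e , s) (e′ , s′) = (λ x → trans (e x) (e′ x)) , λ {x} {y} u → begin
    subst₂ Hom (trans (e x) (e′ x)) (trans (e y) (e′ y)) (F₁ F u)
      ≡⟨ subst₂-subst₂ Hom (e x) (e′ x) (e y) (e′ y) _ _ (F₁ F u) ⟨
    subst₂ Hom (e′ x) (e′ y) (subst₂ Hom (e x) (e y) (F₁ F u))
      ≈⟨ ≈-trans (subst₂-resp-≈ (e′ x) (e′ y) (s u)) (s′ u) ⟩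
    F₁ H u ∎
    where open HomReasoning

  FunctorEq⇒NatTrans : {F G : Functor X Y} → FunctorEq F G → NatTrans F G
  FunctorEq⇒NatTrans (e , s) = record
    { η = λ x → idTo (e x) ; natural = λ u → subst₂-≈⇒idTo-square (e _) (e _) (s u) }

module _ {Y : Groupoid a′ b′ c′} where
  open Groupoid Y
  open GroupoidProperties Y

  _∘ᵥ_ : {F G H : Functor X Y} → NatTrans G H → NatTrans F G → NatTrans F H
  _∘ᵥ_ {F = F} {G} {H} β α = record
    { η = λ x → η β x ∘ η α x
    ; natural = λ {x} {y} u → begin
        (η β y ∘ η α y) ∘ F₁ F u ≈⟨ ≈-trans (assoc _ _ _) (∘-resp-≈ʳ (natural α u)) ⟩
        η β y ∘ (F₁ G u ∘ η α x) ≈⟨ ≈-trans sym-assoc (∘-resp-≈ˡ (natural β u)) ⟩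
        (F₁ H u ∘ η β x) ∘ η α x ≈⟨ assoc _ _ _ ⟩
        F₁ H u ∘ (η β x ∘ η α x) ∎
    }
    where open HomReasoning

  whiskerˡ : {F G : Functor X W} (N : Functor W Y) → NatTrans F G → NatTrans (N ∘F F) (N ∘F G)
  whiskerˡ {W = W} {F = F} {G} N α = record
    { η = λ x → F₁ N (η α x)
    ; natural = λ {x} {y} u → begin
        F₁ N (η α y) ∘ F₁ N (F₁ F u) ≈⟨ ≈-sym (F-∘ N _ _) ⟩
        F₁ N (_ ∘W _)                ≈⟨ F-resp-≈ N (natural α u) ⟩
        F₁ N (_ ∘W _)                ≈⟨ F-∘ N _ _ ⟩
        F₁ N (F₁ G u) ∘ F₁ N (η α x) ∎
    }
    where open HomReasoning
          open Groupoid W using () renaming (_∘_ to _∘W_)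

whiskerʳ : {F G : Functor Y Z} → NatTrans F G → (K : Functor X Y) → NatTrans (F ∘F K) (G ∘F K)
whiskerʳ α K = record { η = λ x → η α (F₀ K x) ; natural = λ u → natural α (F₁ K u) }

module _ {Z : Groupoid a″ b″ c″} where
  open Groupoid Z
  open GroupoidProperties Z

  conjugate-unique : (N : Functor Y Z) (G : Functor X Y) (H₀ : Groupoid.Obj X → Groupoid.Obj Y)
    (θ : ∀ x → Groupoid.Hom Y (F₀ G x) (H₀ x)) (Q : Functor X Z) (α : NatTrans (N ∘F G) Q)
    (e : ∀ x → F₀ N (H₀ x) ≡ F₀ Q x) → (∀ x → idTo (e x) ∘ F₁ N (θ x) ≈ η α x) →
    FunctorEq (N ∘F conjugate G H₀ θ) Q
  conjugate-unique {Y = Y} N G H₀ θ Q α e agree = e , λ {x} {y} u →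
    idTo-square⇒subst₂-≈ (e x) (e y) (begin
      idTo (e y) ∘ F₁ N (θ y Y.∘ (F₁ G u Y.∘ θ x Y.⁻¹))
        ≈⟨ ∘-resp-≈ʳ (≈-trans (F-∘ N _ _) (∘-resp-≈ʳ (F-∘ N _ _))) ⟩
      idTo (e y) ∘ (F₁ N (θ y) ∘ (F₁ N (F₁ G u) ∘ F₁ N (θ x Y.⁻¹)))
        ≈⟨ ≈-trans sym-assoc (∘-resp-≈ˡ (agree y)) ⟩
      η α y ∘ (F₁ N (F₁ G u) ∘ F₁ N (θ x Y.⁻¹))
        ≈⟨ ≈-trans sym-assoc (∘-resp-≈ˡ (natural α u)) ⟩
      (F₁ Q u ∘ η α x) ∘ F₁ N (θ x Y.⁻¹)
        ≈⟨ ∘-resp-≈ˡ (∘-resp-≈ʳ (≈-sym (agree x))) ⟩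
      (F₁ Q u ∘ (idTo (e x) ∘ F₁ N (θ x))) ∘ F₁ N (θ x Y.⁻¹)
        ≈⟨ ≈-trans (∘-resp-≈ˡ sym-assoc) (cancelʳ (F-inverseʳ N (θ x))) ⟩
      F₁ Q u ∘ idTo (e x) ∎)
    where open HomReasoning
          module Y = Groupoid Y

  cylinderNat : (Φ : Functor (X ×G 𝐈) Z) → NatTrans ((Φ ∘F incl false) ∘F πF₁) Φ
  cylinderNat {X = X} Φ = record
    { η = λ (x , b) → F₁ Φ {x , false} {x , b} (X.id , tt)
    ; natural = λ {(x , b)} {(x′ , b′)} (u , _) → begin
        F₁ Φ {x′ , false} {x′ , b′} (X.id , tt) ∘ F₁ Φ (u , tt)
          ≈⟨ ≈-sym (F-∘ Φ {x , false} {x′ , false} {x′ , b′} _ _) ⟩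
        F₁ Φ {x , false} {x′ , b′} (X.id X.∘ u , tt)
          ≈⟨ F-resp-≈ Φ (X.≈-trans (X.identityˡ u) (X.≈-sym (X.identityʳ u)) , tt) ⟩
        F₁ Φ {x , false} {x′ , b′} (u X.∘ X.id , tt)
          ≈⟨ F-∘ Φ {x , false} {x , b} {x′ , b′} _ _ ⟩
        F₁ Φ (u , tt) ∘ F₁ Φ {x , false} {x , b} (X.id , tt) ∎
    }
    where open HomReasoning
          module X = Groupoid X

module _ {X : Groupoid a b c} {Y : Groupoid a′ b′ c′} (G : Functor X Y)
         (H₁ : Groupoid.Obj X → Groupoid.Obj Y)
         (θ : ∀ x → Groupoid.Hom Y (F₀ G x) (H₁ x)) where
  open Groupoid Y
  open GroupoidProperties Y

  isoCylinder₀ : Groupoid.Obj X × Bool → Obj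
  isoCylinder₀ (x , false) = F₀ G x
  isoCylinder₀ (x , true) = H₁ x

  isoCylinderη : ∀ xb → Hom (F₀ G (proj₁ xb)) (isoCylinder₀ xb)
  isoCylinderη (x , false) = id
  isoCylinderη (x , true) = θ x

  isoCylinder : Functor (X ×G 𝐈) Y
  isoCylinder = conjugate (G ∘F πF₁) isoCylinder₀ isoCylinderη

  isoCylinder-at₀ : FunctorEq (isoCylinder ∘F incl false) G
  isoCylinder-at₀ = (λ _ → refl) , λ u →
    ≈-trans (identityˡ _) (≈-trans (∘-resp-≈ʳ id⁻¹≈id) (identityʳ _))

  isoCylinder-at₁ : FunctorEq (isoCylinder ∘F incl true) (conjugate G H₁ θ)
  isoCylinder-at₁ = (λ _ → refl) , λ _ → ≈-refl

module PGAsm {o ℓ} (𝐑 : RealizerCategory o ℓ) where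
  open RealizerCategory 𝐑
  open Category cat
  open CartesianClosed ccc
  open IntervalData interval using (*)
  open Realizer 𝐑

  path-subst₂ : ∀ {A a a′ b b′} (p : a ≡ a′) (q : b ≡ b′) (α : PiHom A a b) →
                path (subst₂ (PiHom A) p q α) ≡ path α
  path-subst₂ refl refl α = refl

  Π-NatTrans : ∀ {A} {F G : Functor W (Π A)} (e : ∀ w → F₀ F w ≡ F₀ G w) →
    (∀ {v w} (u : Groupoid.Hom W v w) → path (F₁ F u) ≡ path (F₁ G u)) → NatTrans F G
  Π-NatTrans {F = F} {G} e s =
    FunctorEq⇒NatTrans {F = F} {G = G} (e , λ u → trans (path-subst₂ (e _) (e _) _) (s u))

  !-absorb : ∀ {K A B} (t : Hom 𝟙 B) (k : Hom K A) (s : Hom K 𝟙) → (t ∘ !) ∘ k ≡ t ∘ s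
  !-absorb t k s = trans (assoc k ! t) (cong (t ∘_) (trans (!-unique _) (sym (!-unique s))))

  π₁-absorb : ∀ {K A B C} (t : Hom A B) (k : Hom K A) (s : Hom K C) → (t ∘ π₁) ∘ ⟨ k , s ⟩ ≡ t ∘ k
  π₁-absorb t k s = trans (assoc ⟨ k , s ⟩ π₁ t) (cong (t ∘_) (π₁-⟨⟩ k s))

  module _ {ℓo ℓh ℓe : Level} where

    constPMor : (X Y : PObj ℓo ℓh ℓe) → Groupoid.Obj (carrier Y) → PMor X Y
    constPMor X Y y = record
      { functor = constF (carrier X) (carrier Y) y
      ; tracker = ‖y‖ ∘ !
      ; tracking = normConst ∘ᵥ trackerConst
      }
      where
        ‖y‖ : Hom 𝟙 (realizer Y)
        ‖y‖ = F₀ (norm Y) y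
        trackerConst : NatTrans (Πmap (‖y‖ ∘ !) ∘F norm X) (constF (carrier X) (Π (realizer Y)) ‖y‖)
        trackerConst = Π-NatTrans (λ _ → trans (!-absorb ‖y‖ _ id) (identityʳ ‖y‖))
                                  (λ _ → !-absorb ‖y‖ _ *)
        normConst : NatTrans (constF (carrier X) (Π (realizer Y)) ‖y‖)
                             (norm Y ∘F constF (carrier X) (carrier Y) y)
        normConst = Π-NatTrans (λ _ → refl) (λ _ → sym (F-id (norm Y)))

    precompπ₁ : {X Y : PObj ℓo ℓh ℓe} → PMor X Y → PMor (X ⊗P 𝐈₁) Y
    precompπ₁ {X} {Y} f = record
      { functor = functor f ∘F πF₁
      ; tracker = tracker f ∘ π₁
      ; tracking = reassoc ∘ᵥ (whiskerʳ (tracking f) πF₁ ∘ᵥ trackerProj)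
      }
      where
        trackerProj : NatTrans (Πmap (tracker f ∘ π₁) ∘F norm (X ⊗P 𝐈₁))
                               ((Πmap (tracker f) ∘F norm X) ∘F πF₁)
        trackerProj = Π-NatTrans (λ _ → π₁-absorb (tracker f) _ _) (λ _ → π₁-absorb (tracker f) _ _)
        reassoc : NatTrans ((norm Y ∘F functor f) ∘F πF₁) (norm Y ∘F (functor f ∘F πF₁))
        reassoc = Π-NatTrans (λ _ → refl) (λ _ → refl)

    conjugatePMor : {X Y : PObj ℓo ℓh ℓe} (f : PMor X Y)
      (H₀ : Groupoid.Obj (carrier X) → Groupoid.Obj (carrier Y))
      (θ : ∀ x → Groupoid.Hom (carrier Y) (F₀ (functor f) x) (H₀ x)) → PMor X Y
    conjugatePMor {Y = Y} f H₀ θ = record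
      { functor = conjugate (functor f) H₀ θ
      ; tracker = tracker f
      ; tracking = whiskerˡ (norm Y) (conjugateIso (functor f) H₀ θ) ∘ᵥ tracking f
      }

    isoCylinderPMor : {X Y : PObj ℓo ℓh ℓe} (f : PMor X Y)
      (H₁ : Groupoid.Obj (carrier X) → Groupoid.Obj (carrier Y))
      (θ : ∀ x → Groupoid.Hom (carrier Y) (F₀ (functor f) x) (H₁ x)) → PMor (X ⊗P 𝐈₁) Y
    isoCylinderPMor f H₁ θ =
      conjugatePMor (precompπ₁ f) (isoCylinder₀ (functor f) H₁ θ) (isoCylinderη (functor f) H₁ θ)

    isoTwoCell : {X Y : PObj ℓo ℓh ℓe} (f : PMor X Y)
      (H₁ : Groupoid.Obj (carrier X) → Groupoid.Obj (carrier Y))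
      (θ : ∀ x → Groupoid.Hom (carrier Y) (F₀ (functor f) x) (H₁ x)) →
      TwoCell {X = X} {Y = Y} (functor f) (conjugate (functor f) H₁ θ)
    isoTwoCell f H₁ θ = record
      { cell = isoCylinderPMor f H₁ θ
      ; at₀ = isoCylinder-at₀ (functor f) H₁ θ
      ; at₁ = isoCylinder-at₁ (functor f) H₁ θ
      }

    pointGpd : Groupoid ℓo ℓh ℓe
    pointGpd = record
      { Obj = Lift ℓo ⊤ ; Hom = λ _ _ → Lift ℓh ⊤ ; _≈_ = λ _ _ → Lift ℓe ⊤
      ; id = lift tt ; _∘_ = λ _ _ → lift tt ; _⁻¹ = λ _ → lift tt
      ; ≈-refl = lift tt ; ≈-sym = λ _ → lift tt ; ≈-trans = λ _ _ → lift tt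
      ; ∘-resp-≈ = λ _ _ → lift tt ; assoc = λ _ _ _ → lift tt
      ; identityˡ = λ _ → lift tt ; identityʳ = λ _ → lift tt
      ; inverseˡ = λ _ → lift tt ; inverseʳ = λ _ → lift tt }

    pointP : PObj ℓo ℓh ℓe
    pointP = pobj pointGpd 𝟙 (constF pointGpd (Π 𝟙) id)

    pointTwoCell : {Y Z : PObj ℓo ℓh ℓe} (F : PMor Y Z) (y : Groupoid.Obj (carrier Y))
      (z : Groupoid.Obj (carrier Z)) → Groupoid.Hom (carrier Z) (F₀ (functor F) y) z →
      TwoCell {X = pointP} {Y = Z} (functor F ∘F constF pointGpd (carrier Y) y)
                                   (constF pointGpd (carrier Z) z)
    pointTwoCell {Z = Z} F y z φ = record
      { cell = isoCylinderPMor (constPMor pointP Z (F₀ (functor F) y)) (λ _ → z) (λ _ → φ)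
      ; at₀ = (λ _ → refl) , λ _ →
          Z.≈-trans (Z.identityˡ _) (Z.≈-trans (Z.inverseʳ _) (Z.≈-sym (F-id (functor F))))
      ; at₁ = (λ _ → refl) , λ _ →
          Z.≈-trans (GroupoidProperties.∘-resp-≈ʳ (carrier Z) (Z.identityˡ _)) (Z.inverseʳ φ)
      }
      where module Z = Groupoid (carrier Z)

    isofibration₂⇒isofibrationGpd : {Y Z : PObj ℓo ℓh ℓe} (F : PMor Y Z) →
      IsIsofibration₂ F → IsIsofibrationGpd (functor F)
    isofibration₂⇒isofibrationGpd {Y} {Z} F iso₂ y z φ
      with iso₂ pointP (constPMor pointP Y y) (constPMor pointP Z z) (pointTwoCell F y z φ)
    ... | f′ , f′-over , φ̄ , φ̄-over = F₀ (functor f′) pt , proj₁ f′-over pt , ψ , ψ-lifts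
      where
        module Y = Groupoid (carrier Y)
        module Z = Groupoid (carrier Z)
        open GroupoidProperties (carrier Z)
        pt : Lift ℓo ⊤
        pt = lift tt
        C : Functor (pointGpd ×G 𝐈) (carrier Y)
        C = functor (cell φ̄)
        c₀ : F₀ C (pt , false) ≡ y
        c₀ = proj₁ (at₀ φ̄) pt
        c₁ : F₀ C (pt , true) ≡ F₀ (functor f′) pt
        c₁ = proj₁ (at₁ φ̄) pt
        m : Y.Hom (F₀ C (pt , false)) (F₀ C (pt , true))
        m = F₁ C (lift tt , tt)
        ψ : Y.Hom y (F₀ (functor f′) pt)
        ψ = subst₂ Y.Hom c₀ c₁ m
        over : ∀ b → F₀ (functor F) (F₀ C (pt , b)) ≡ F₀ (functor (cell (pointTwoCell F y z φ))) (pt , b)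
        over b = proj₁ φ̄-over (pt , b)
        ψ-lifts : subst₂ Z.Hom refl (proj₁ f′-over pt) (F₁ (functor F) ψ) Z.≈ φ
        ψ-lifts = begin
          subst₂ Z.Hom refl (proj₁ f′-over pt) (F₁ (functor F) ψ)
            ≡⟨ cong (subst₂ Z.Hom refl _) (F₁-subst₂ (functor F) c₀ c₁ m) ⟩
          subst₂ Z.Hom refl (proj₁ f′-over pt)
            (subst₂ Z.Hom (cong (F₀ (functor F)) c₀) (cong (F₀ (functor F)) c₁) (F₁ (functor F) m))
            ≡⟨ subst₂-subst₂ Z.Hom (cong (F₀ (functor F)) c₀) refl (cong (F₀ (functor F)) c₁)
                             (proj₁ f′-over pt) (over false) (over true) _ ⟩
          subst₂ Z.Hom (over false) (over true) (F₁ (functor F) m)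
            ≈⟨ proj₂ φ̄-over {pt , false} {pt , true} (lift tt , tt) ⟩
          φ Z.∘ (Z.id Z.∘ Z.id Z.⁻¹)
            ≈⟨ Z.≈-trans (∘-resp-≈ʳ (Z.inverseʳ Z.id)) (Z.identityʳ φ) ⟩
          φ ∎
          where open HomReasoning

    module ComponentwiseLift {X Y Z : PObj ℓo ℓh ℓe} (F : PMor Y Z)
      (isoF : IsIsofibrationGpd (functor F)) (f : PMor X Y) (g : PMor X Z)
      (φ : TwoCell {X = X} {Y = Z} (functor F ∘F functor f) (functor g)) where
      private
        module X = Groupoid (carrier X)
        module Y = Groupoid (carrier Y)
        module Z = Groupoid (carrier Z)
      open GroupoidProperties (carrier Z)

      Φ : Functor (carrier X ×G 𝐈) (carrier Z)
      Φ = functor (cell φ)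

      at₀-cylinder : FunctorEq (functor F ∘F (functor f ∘F πF₁ {Y = 𝐈})) ((Φ ∘F incl false) ∘F πF₁)
      at₀-cylinder = (λ (x , _) → sym (proj₁ (at₀ φ) x)) ,
                     λ (u , _) → subst₂-sym-≈ _ _ (proj₂ (at₀ φ) u)

      α : NatTrans (functor F ∘F (functor f ∘F πF₁)) Φ
      α = cylinderNat Φ ∘ᵥ FunctorEq⇒NatTrans at₀-cylinder

      y′ : X.Obj → Y.Obj
      y′ x = proj₁ (isoF _ _ (η α (x , true)))

      p : ∀ x → F₀ (functor F) (y′ x) ≡ F₀ Φ (x , true)
      p x = proj₁ (proj₂ (isoF _ _ (η α (x , true))))

      ψ : ∀ x → Y.Hom (F₀ (functor f) x) (y′ x)
      ψ x = proj₁ (proj₂ (proj₂ (isoF _ _ (η α (x , true)))))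

      ψ-lifts : ∀ x → subst₂ Z.Hom refl (p x) (F₁ (functor F) (ψ x)) Z.≈ η α (x , true)
      ψ-lifts x = proj₂ (proj₂ (proj₂ (isoF _ _ (η α (x , true)))))

      ends : ∀ xb → F₀ (functor F) (isoCylinder₀ (functor f) y′ ψ xb) ≡ F₀ Φ xb
      ends (x , false) = sym (proj₁ (at₀ φ) x)
      ends (x , true) = p x

      ends-agree : ∀ xb →
        idTo (ends xb) Z.∘ F₁ (functor F) (isoCylinderη (functor f) y′ ψ xb) Z.≈ η α xb
      ends-agree (x , false) = begin
        idTo (ends (x , false)) Z.∘ F₁ (functor F) Y.id ≈⟨ ∘-resp-≈ʳ (F-id (functor F)) ⟩
        idTo (ends (x , false)) Z.∘ Z.id                ≈⟨ Z.identityʳ _ ⟩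
        idTo (ends (x , false))                         ≈⟨ Z.≈-sym (Z.identityˡ _) ⟩
        Z.id Z.∘ idTo (ends (x , false))                ≈⟨ ∘-resp-≈ˡ (Z.≈-sym (F-id Φ)) ⟩
        η α (x , false)                                 ∎
        where open HomReasoning
      ends-agree (x , true) =
        Z.≈-trans (subst₂-≈⇒idTo-square refl (p x) (ψ-lifts x)) (Z.identityʳ _)

      lift-over-φ : FunctorEq (functor F ∘F functor (cell (isoTwoCell f y′ ψ))) Φ
      lift-over-φ = conjugate-unique (functor F) (functor f ∘F πF₁) _ _ Φ α ends ends-agree

      lift-over-g : FunctorEq (functor F ∘F conjugate (functor f) y′ ψ) (functor g)
      lift-over-g = FunctorEq-trans {F = functor F ∘F conjugate (functor f) y′ ψ}
                                    {G = Φ ∘F incl true} {H = functor g}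
        ((λ x → proj₁ lift-over-φ (x , true)) , λ u → proj₂ lift-over-φ (u , tt))
        (at₁ φ)

    isofibrationGpd⇒isofibration₂ : {Y Z : PObj ℓo ℓh ℓe} (F : PMor Y Z) →
      IsIsofibrationGpd (functor F) → IsIsofibration₂ F
    isofibrationGpd⇒isofibration₂ F isoF X f g φ =
      conjugatePMor f y′ ψ , lift-over-g , isoTwoCell f y′ ψ , lift-over-φ
      where open ComponentwiseLift F isoF f g φ

mainTheorem5 : ∀ {o ℓ x h e : Level} (𝐑 : RealizerCategory o ℓ) →
    Realizer.∂-isIso 𝐑 →
    {Y Z : Realizer.PObj 𝐑 x h e} (F : Realizer.PMor 𝐑 Y Z) →
    (Realizer.IsIsofibration₂ 𝐑 F → IsIsofibrationGpd (Realizer.functor F)) ×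
    (IsIsofibrationGpd (Realizer.functor F) → Realizer.IsIsofibration₂ 𝐑 F)
mainTheorem5 𝐑 _ F =
  PGAsm.isofibration₂⇒isofibrationGpd 𝐑 F , PGAsm.isofibrationGpd⇒isofibration₂ 𝐑 F
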